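{- Let $s\ge 2$ and let $S=S_s$ be the sum gadget (context). Then $S$ contains end gadget-cycles $Z,A_0,\dots,A_{s-1}$, copies of $Z$, pairwise at distance at least $2$, and a tree $T=T(S)$ containing the copy of the vertex $0$ in each of these end gadget-cycles. Further: (1) for any homomorphism $\Gamma:S\to H$, if $[\Gamma(Z)]=0$ then $[\Gamma(C)]=0$ for all gadget-cycles $C$ of $S$ except possibly the $A_i$; (2) for any homomorphism $\Gamma:S\to H$, $[\Gamma(Z)]=\sum_{i\in[s]}[\Gamma(A_i)]$ in $H_1(\mathbf{H})$; (3) for each $i\in[s]$ there is a homomorphism $\Gamma_i:S\to H$ with $[\Gamma_i(A_i)]=[Z]$ and with $\Gamma_i$ constant $0$ on $T$ and on $A_j$ for $j\ne i$.
   Context: All graphs reflexive (loops at every vertex). $H$ is a connected triangle-free reflexive graph with non-trivial $H_1(\mathbf{H})$ (first homology of the clique complex: simplices are ordered tuples of pairwise equal-or-adjacent vertices, integer chains, alternating-sum boundary; closed walks identified with the 1-cycle of their consecutive edges, $[\cdot]$ = class), and $Z=(0,1,\dots,g-1,0)$, $g\ge4$, is a fixed shortest homologically non-trivial cycle of $H$. $[n]=\{0,\dots,n-1\}$. $P_\ell$ is the reflexive path on $0,\dots,\ell$; $A\times B$ is the categorical product; $j\times B$ is the slice $\{(j,b)\}$. Let $B$ be the reflexive cycle of length $sg$ on vertices $0,1,\dots,sg-1$ (in cyclic order). Define $\beta:B\to Z$ by $\beta(js+i)=j$ ($j\in[g]$, $i\in[s]$) and for $k\in[s]$, $\alpha_k:B\to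 Z$ by $\alpha_k(ig+j)=j$ if $i=k$ and $0$ otherwise ($i\in[s]$, $j\in[g]$). Fix an integer $\ell\ge2$ such that for each $i\in[s]$ there is a homomorphism $\phi_i:P_\ell\times B\to Z$ with $\phi_i|_{0\times B}=\alpha_i$, $\phi_i|_{\ell\times B}=\beta$, and $\phi_i\equiv0$ on $P_\ell\times\{0\}$ (such $\ell$ exists). Construct $S_s$ from $P_\ell\times B$: (1) for each $j\in[g]$ identify the vertices $(\ell,js+i)$, $i\in[s]$; the slice $\ell\times B$ becomes a copy of $Z$ called $Z$, its vertex from block $j$ labelled $j$; (2) identify the vertices $(0,ig)$, $i\in[s]$; the slice $0\times B$ becomes $s$ copies $A_0',\dots,A_{s-1}'$ of $Z$ sharing one vertex, with $(0,ig+j)$ labelled $j$ in $A_i'$; (3) for each $i\in[s]$ take a new copy of $P_1\times Z$, identify one slice with $A_i'$ (label-preserving) and call the other slice $A_i$ (labels inherited). All these copies of $Z$ are oriented by their labels $0\to1\to\dots\to g-1\to0$. Gadget-cycles of $S$: the images of the slices $j\times B$ and the $A_i$; end gadget-cycles: $Z$ and the $A_i$. $T(S)$ is the subgraph induced by the images of the vertices $(j,0)$, $j\in\{0,\dots,\ell\}$, and the vertex labelled $0$ in each $A_i$. -}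

module Defs where

open import Data.Nat using (ℕ; zero; suc; _≤_; _<_; _*_) renaming (_+_ to _+ℕ_)
open import Data.Integer using (ℤ; 0ℤ; 1ℤ; _+_; _-_)
open import Data.Fin using (Fin) renaming (zero to fzero; suc to fsuc)
open import Data.Fin.Properties using () renaming (_≟_ to _≟F_)
open import Data.Bool using (if_then_else_; _∧_)
open import Data.List using (List; []; _∷_; map; upTo; _++_; [_])
open import Data.Product using (Σ; Σ-syntax; _×_; _,_)
open import Data.Sum using (_⊎_)
open import Data.Empty using (⊥)
open import Relation.Nullary using (¬_; does)
open import Relation.Binary.PropositionalEquality using (_≡_; _≢_)

-- adjacency in the reflexive cycle of length m on 0,…,m-1 (arguments < m)
CycAdj : ℕ → ℕ → ℕ → Set
CycAdj m x y = x ≡ y ⊎ suc x ≡ y ⊎ suc y ≡ x ⊎ (suc x ≡ m × y ≡ 0) ⊎ (suc y ≡ m × x ≡ 0)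

-- adjacency in the reflexive path P_ℓ (arguments ≤ ℓ)
PathAdj : ℕ → ℕ → Set
PathAdj a a' = a ≡ a' ⊎ suc a ≡ a' ⊎ suc a' ≡ a

data Walk {A : Set} (R : A → A → Set) : A → A → Set where
  here : ∀ {u} → Walk R u u
  step : ∀ {u v w} → R u v → Walk R v w → Walk R u w

Reflexive : ∀ {n} → (Fin n → Fin n → Set) → Set
Reflexive {n} E = ∀ (x : Fin n) → E x x

Symmetric : ∀ {n} → (Fin n → Fin n → Set) → Set
Symmetric {n} E = ∀ (x y : Fin n) → E x y → E y x

Connected : ∀ {n} → (Fin n → Fin n → Set) → Set
Connected {n} E = ∀ (x y : Fin n) → Walk E x y

TriangleFree : ∀ {n} → (Fin n → Fin n → Set) → Set
TriangleFree {n} E = ∀ (a b c : Fin n) → a ≢ b → b ≢ c → a ≢ c →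
  E a b → E b c → E a c → ⊥

IsCycleH : ∀ {n} → (Fin n → Fin n → Set) → ℕ → (ℕ → Fin n) → Set
IsCycleH E k f =
  (∀ a b → a < k → b < k → f a ≡ f b → a ≡ b) ×
  (∀ a b → a < k → b < k → CycAdj k a b → E (f a) (f b))

-- Simplicial chains of the clique complex (ordered simplices, ℤ coefficients)

sumFin : ∀ n → (Fin n → ℤ) → ℤ
sumFin zero f = 0ℤ
sumFin (suc n) f = f fzero + sumFin n (λ i → f (fsuc i))

Chain0 Chain1 Chain2 : ℕ → Set
Chain0 n = Fin n → ℤ
Chain1 n = Fin n → Fin n → ℤ
Chain2 n = Fin n → Fin n → Fin n → ℤ

-- ∂(a,b) = b - a
∂₁ : ∀ {n} → Chain1 n → Chain0 n
∂₁ {n} c x = sumFin n (λ u → c u x) - sumFin n (λ v → c x v)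

-- ∂(a,b,c) = (b,c) - (a,c) + (a,b)
∂₂ : ∀ {n} → Chain2 n → Chain1 n
∂₂ {n} d u v = sumFin n (λ w → (d w u v - d u w v) + d u v w)

Null : ∀ {n} → (Fin n → Fin n → Set) → Chain1 n → Set
Null {n} E c = Σ[ d ∈ Chain2 n ]
  ((∀ a b x → d a b x ≢ 0ℤ → E a b × E b x × E a x) ×
   (∀ u v → ∂₂ d u v ≡ c u v))

Homologous : ∀ {n} → (Fin n → Fin n → Set) → Chain1 n → Chain1 n → Set
Homologous E c c' = Null E (λ u v → c u v - c' u v)

NontrivialH1 : ∀ {n} → (Fin n → Fin n → Set) → Set
NontrivialH1 {n} E = Σ[ c ∈ Chain1 n ]
  ((∀ a b → c a b ≢ 0ℤ → E a b) × (∀ x → ∂₁ c x ≡ 0ℤ) × ¬ Null E c)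

edgeChain : ∀ {n} → Fin n → Fin n → Chain1 n
edgeChain a b u v = if does (a ≟F u) ∧ does (b ≟F v) then 1ℤ else 0ℤ

zeroChain : ∀ {n} → Chain1 n
zeroChain _ _ = 0ℤ

_⊕_ : ∀ {n} → Chain1 n → Chain1 n → Chain1 n
(c ⊕ c') u v = c u v + c' u v

pathChain : ∀ {n} → List (Fin n) → Chain1 n
pathChain [] = zeroChain
pathChain (a ∷ []) = zeroChain
pathChain (a ∷ b ∷ rest) = edgeChain a b ⊕ pathChain (b ∷ rest)

closedChain : ∀ {n} → List (Fin n) → Chain1 n
closedChain [] = zeroChain
closedChain (x ∷ xs) = pathChain (x ∷ xs ++ [ x ])

chainSum : ∀ {n} → List (Chain1 n) → Chain1 n
chainSum [] = zeroChain
chainSum (c ∷ cs) = c ⊕ chainSum cs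

ShortestNontrivialCycle : ∀ {n} → (Fin n → Fin n → Set) → ℕ → (ℕ → Fin n) → Set
ShortestNontrivialCycle {n} E g z =
  IsCycleH E g z × ¬ Null E (closedChain (map z (upTo g))) ×
  (∀ k (f : ℕ → Fin n) → 3 ≤ k → k < g → IsCycleH E k f →
     Null E (closedChain (map f (upTo k))))

-- φ : P_ℓ × B → Z (reflexive cycle of length g), B the reflexive cycle of length s g,
-- with φ|0×B = α_i, φ|ℓ×B = β, φ ≡ 0 on P_ℓ × {0}
GoodPhi : (s g ℓ i : ℕ) → (ℕ → ℕ → ℕ) → Set
GoodPhi s g ℓ i φ =
  (∀ a b → a ≤ ℓ → b < s * g → φ a b < g) ×
  (∀ a b a' b' → a ≤ ℓ → b < s * g → a' ≤ ℓ → b' < s * g →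
     PathAdj a a' → CycAdj (s * g) b b' → CycAdj g (φ a b) (φ a' b')) ×
  (∀ i' j → i' < s → j < g →
     (i' ≡ i → φ 0 (i' * g +ℕ j) ≡ j) × (i' ≢ i → φ 0 (i' * g +ℕ j) ≡ 0)) ×
  (∀ j i' → j < g → i' < s → φ ℓ (j * s +ℕ i') ≡ j) ×
  (∀ a → a ≤ ℓ → φ a 0 ≡ 0)

-- raw vertices: main a b = (a , b) ∈ P_ℓ × B ;
-- ext i j = vertex j of the far slice A_i of the i-th extra copy of P₁ × Z.
-- (The near slice of that copy is identified with A_i', i.e. its vertex j is main 0 (i g + j).)
data RV : Set where
  main : ℕ → ℕ → RV
  ext  : ℕ → ℕ → RV

module Gadget (s g ℓ : ℕ) where

  Valid : RV → Set
  Valid (main a b) = a ≤ ℓ × b < s * g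
  Valid (ext i j) = i < s × j < g

  SameBlock : ℕ → ℕ → Set
  SameBlock b b' = Σ[ j ∈ ℕ ] Σ[ i ∈ ℕ ] Σ[ i' ∈ ℕ ]
    (i < s × i' < s × b ≡ j * s +ℕ i × b' ≡ j * s +ℕ i')

  MultipleOf : ℕ → ℕ → Set
  MultipleOf m b = Σ[ i ∈ ℕ ] b ≡ i * m

  Same : RV → RV → Set
  Same (main a b) (main a' b') =
    a ≡ a' × (b ≡ b' ⊎ (a ≡ ℓ × SameBlock b b') ⊎ (a ≡ 0 × MultipleOf g b × MultipleOf g b'))
  Same (main _ _) (ext _ _) = ⊥
  Same (ext _ _) (main _ _) = ⊥
  Same (ext i j) (ext i' j') = i ≡ i' × j ≡ j'

  RawAdj : RV → RV → Set
  RawAdj (main a b) (main a' b') = PathAdj a a' × CycAdj (s * g) b b'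
  RawAdj (ext i j) (ext i' j') = i ≡ i' × CycAdj g j j'
  RawAdj (ext i j) (main a b) =
    a ≡ 0 × Σ[ j' ∈ ℕ ] (j' < g × b ≡ i * g +ℕ j' × CycAdj g j j')
  RawAdj (main a b) (ext i j) =
    a ≡ 0 × Σ[ j' ∈ ℕ ] (j' < g × b ≡ i * g +ℕ j' × CycAdj g j' j)

  Adj : RV → RV → Set
  Adj u v = Valid u × Valid v × Σ[ u' ∈ RV ] Σ[ v' ∈ RV ]
    (Valid u' × Valid v' × Same u u' × Same v v' × RawAdj u' v')

  IsHom : ∀ {n} → (Fin n → Fin n → Set) → (RV → Fin n) → Set
  IsHom E Γ =
    (∀ u v → Valid u → Valid v → Same u v → Γ u ≡ Γ v) ×
    (∀ u v → Valid u → Valid v → RawAdj u v → E (Γ u) (Γ v))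

  -- end gadget-cycle Z: its vertex j is the image of block j of ℓ × B
  ZV : ℕ → RV
  ZV j = main ℓ (j * s)

  -- end gadget-cycles indexed by k ≤ s : 0 ↦ Z, suc i ↦ A_i
  EndCyc : ℕ → ℕ → RV
  EndCyc zero = ZV
  EndCyc (suc i) = ext i

  EndList : ℕ → List RV
  EndList k = map (EndCyc k) (upTo g)

  SliceList : ℕ → List RV
  SliceList j = map (main j) (upTo (s * g))

  IsCopyOfZ : (ℕ → RV) → Set
  IsCopyOfZ c =
    (∀ j → j < g → Valid (c j)) ×
    (∀ j j' → j < g → j' < g → Same (c j) (c j') → j ≡ j') ×
    (∀ j j' → j < g → j' < g → (Adj (c j) (c j') → CycAdj g j j') × (CycAdj g j j' → Adj (c j) (c j')))

  InT : RV → Set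
  InT u = Valid u × ((Σ[ j ∈ ℕ ] (j ≤ ℓ × Same u (main j 0))) ⊎ (Σ[ i ∈ ℕ ] (i < s × Same u (ext i 0))))

  InducedTree : (RV → Set) → Set
  InducedTree P =
    (∀ u v → P u → P v → Walk (λ x y → Adj x y × P y) u v) ×
    (∀ k (f : ℕ → RV) → 3 ≤ k → (∀ a → a < k → P (f a)) →
       (∀ a b → a < k → b < k → Same (f a) (f b) → a ≡ b) →
       (∀ a b → a < k → b < k → CycAdj k a b → Adj (f a) (f b)) → ⊥)

module Submission where

-- Two closed walks joined by a ladder of squares are homologous: split each square along a diagonal
-- into two triangles of the clique complex. Consecutive slices j × B and (j + 1) × B are joined by
-- such a ladder, so all slice cycles are homologous; the top slice runs around Z pausing s steps on
-- each vertex, and pauses on a looped vertex contribute nothing, so it is homologous to Z. This gives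
-- (1). The bottom slice is the concatenation of the cycles A′ᵢ, and the cylinder P₁ × Z is a ladder
-- from A′ᵢ to Aᵢ, which gives (2). For (3), z ∘ φᵢ respects the identifications of S, because φᵢ is
-- constant on the blocks of ℓ × B and vanishes on the vertices (0, i g); it extends to the cylinders
-- by the identity of Z on the i-th one and the constant z 0 on the others.

open import Defs
open import Data.Bool using (Bool; true; false; if_then_else_; _∧_)
open import Data.Empty using (⊥; ⊥-elim)
open import Data.Fin using (Fin) renaming (zero to fzero; suc to fsuc)
open import Data.Fin.Properties using () renaming (_≟_ to _≟F_)
open import Data.Integer using (ℤ; 0ℤ; 1ℤ; -_; _-_) renaming (_+_ to _+ℤ_)
import Data.Integer.Properties as ℤₚ
open import Data.Integer.Tactic.RingSolver using (solve-∀)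
open import Data.List using (map; upTo; applyUpTo; _++_; [_])
open import Data.List.Properties using (map-upTo; map-∘; map-cong)
open import Data.Nat using (ℕ; zero; suc; _+_; _*_; _≤_; _<_; z≤n; s≤s; _≟_; _<?_; _≤?_; NonZero)
open import Data.Nat.DivMod using (_%_; n%n≡0; m≤n⇒m%n≡m; m<n⇒m%n≡m; m%n<n; m%n*o≡m*o%[n*o])
open import Data.Nat.Properties
open import Data.Product using (Σ-syntax; _×_; _,_; proj₁; proj₂)
open import Data.Sum using (_⊎_; inj₁; inj₂)
open import Function using (_∘_)
open import Relation.Binary.Bundles using (Setoid)
open import Relation.Binary.PropositionalEquality hiding ([_])
import Relation.Binary.Reasoning.Setoid as SetoidReasoning
open import Relation.Nullary using (¬_; does; yes; no)

𝟙 : Bool → ℤ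
𝟙 b = if b then 1ℤ else 0ℤ

sumFin-cong : ∀ m {f h : Fin m → ℤ} → (∀ i → f i ≡ h i) → sumFin m f ≡ sumFin m h
sumFin-cong zero eq = refl
sumFin-cong (suc m) eq = cong₂ _+ℤ_ (eq fzero) (sumFin-cong m (λ i → eq (fsuc i)))

sumFin-zero : ∀ m → sumFin m (λ _ → 0ℤ) ≡ 0ℤ
sumFin-zero zero = refl
sumFin-zero (suc m) = trans (ℤₚ.+-identityˡ _) (sumFin-zero m)

sumFin-+ : ∀ m (f h : Fin m → ℤ) → sumFin m (λ i → f i +ℤ h i) ≡ sumFin m f +ℤ sumFin m h
sumFin-+ zero f h = refl
sumFin-+ (suc m) f h =
  trans (cong (f fzero +ℤ h fzero +ℤ_) (sumFin-+ m (λ i → f (fsuc i)) (λ i → h (fsuc i))))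
        (interchange (f fzero) (h fzero) _ _)
  where
  interchange : ∀ a b x y → (a +ℤ b) +ℤ (x +ℤ y) ≡ (a +ℤ x) +ℤ (b +ℤ y)
  interchange = solve-∀

sumFin-neg : ∀ m (f : Fin m → ℤ) → sumFin m (λ i → - f i) ≡ - sumFin m f
sumFin-neg zero f = refl
sumFin-neg (suc m) f =
  trans (cong (- f fzero +ℤ_) (sumFin-neg m (λ i → f (fsuc i))))
        (sym (ℤₚ.neg-distrib-+ (f fzero) _))

sumFin-𝟙-≟ : ∀ {m} (a : Fin m) → sumFin m (λ w → 𝟙 (does (a ≟F w))) ≡ 1ℤ
sumFin-𝟙-≟ {suc m} fzero = cong (1ℤ +ℤ_) (sumFin-zero m)
sumFin-𝟙-≟ {suc m} (fsuc a) = trans (ℤₚ.+-identityˡ _) (sumFin-𝟙-≟ a)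

sumFin-𝟙-≟-∧ : ∀ {m} (a : Fin m) B → sumFin m (λ w → 𝟙 (does (a ≟F w) ∧ B)) ≡ 𝟙 B
sumFin-𝟙-≟-∧ {suc m} fzero B = trans (cong (𝟙 B +ℤ_) (sumFin-zero m)) (ℤₚ.+-identityʳ _)
sumFin-𝟙-≟-∧ {suc m} (fsuc a) B = trans (ℤₚ.+-identityˡ _) (sumFin-𝟙-≟-∧ a B)

sumFin-𝟙-∧ : ∀ m B {P : Fin m → Bool} {C} →
  sumFin m (λ w → 𝟙 (P w)) ≡ 𝟙 C → sumFin m (λ w → 𝟙 (B ∧ P w)) ≡ 𝟙 (B ∧ C)
sumFin-𝟙-∧ m true eq = eq
sumFin-𝟙-∧ m false eq = sumFin-zero m

sumFin-𝟙-∧-≟ : ∀ {m} B (c : Fin m) → sumFin m (λ w → 𝟙 (B ∧ does (c ≟F w))) ≡ 𝟙 B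
sumFin-𝟙-∧-≟ true c = sumFin-𝟙-≟ c
sumFin-𝟙-∧-≟ {m} false c = sumFin-zero m

module _ {n : ℕ} where

  infix 4 _≐_
  _≐_ : Chain1 n → Chain1 n → Set
  c ≐ c' = ∀ u v → c u v ≡ c' u v

  simplex : Fin n → Fin n → Fin n → Chain2 n
  simplex a b c x y w = 𝟙 (does (a ≟F x) ∧ does (b ≟F y) ∧ does (c ≟F w))

  simplex-support : ∀ a b c x y w → simplex a b c x y w ≢ 0ℤ → a ≡ x × b ≡ y × c ≡ w
  simplex-support a b c x y w ne with a ≟F x | b ≟F y | c ≟F w
  ... | yes p | yes q | yes r = p , q , r
  ... | no _  | _     | _     = ⊥-elim (ne refl)
  ... | yes _ | no _  | _     = ⊥-elim (ne refl)
  ... | yes _ | yes _ | no _  = ⊥-elim (ne refl)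

  ∂₂-split : ∀ (d : Chain2 n) u v →
    ∂₂ d u v ≡ (sumFin n (λ w → d w u v) - sumFin n (λ w → d u w v)) +ℤ sumFin n (λ w → d u v w)
  ∂₂-split d u v =
    trans (sumFin-+ n (λ w → d w u v - d u w v) (λ w → d u v w))
      (cong (_+ℤ sumFin n (λ w → d u v w))
        (trans (sumFin-+ n (λ w → d w u v) (λ w → - d u w v))
           (cong (sumFin n (λ w → d w u v) +ℤ_) (sumFin-neg n (λ w → d u w v)))))

  ∂₂-simplex : ∀ a b c u v →
    ∂₂ (simplex a b c) u v ≡ (edgeChain b c u v - edgeChain a c u v) +ℤ edgeChain a b u v
  ∂₂-simplex a b c u v = trans (∂₂-split (simplex a b c) u v)
    (cong₂ _+ℤ_
      (cong₂ _-_ (sumFin-𝟙-≟-∧ a _)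
                 (sumFin-𝟙-∧ n (does (a ≟F u)) (sumFin-𝟙-≟-∧ b (does (c ≟F v)))))
      (sumFin-𝟙-∧ n (does (a ≟F u)) (sumFin-𝟙-∧-≟ (does (b ≟F v)) c)))

  ∂₂-+ : ∀ (d d' : Chain2 n) u v → ∂₂ (λ a b c → d a b c +ℤ d' a b c) u v ≡ ∂₂ d u v +ℤ ∂₂ d' u v
  ∂₂-+ d d' u v =
    trans (sumFin-cong n (λ w → regroup (d w u v) (d u w v) (d u v w) (d' w u v) (d' u w v) (d' u v w)))
          (sumFin-+ n (λ w → (d w u v - d u w v) +ℤ d u v w) (λ w → (d' w u v - d' u w v) +ℤ d' u v w))
    where
    regroup : ∀ a b c a' b' c' → ((a +ℤ a') - (b +ℤ b')) +ℤ (c +ℤ c') ≡ ((a - b) +ℤ c) +ℤ ((a' - b') +ℤ c')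
    regroup = solve-∀

  ∂₂-neg : ∀ (d : Chain2 n) u v → ∂₂ (λ a b c → - d a b c) u v ≡ - ∂₂ d u v
  ∂₂-neg d u v =
    trans (sumFin-cong n (λ w → regroup (d w u v) (d u w v) (d u v w)))
          (sumFin-neg n (λ w → (d w u v - d u w v) +ℤ d u v w))
    where
    regroup : ∀ a b c → ((- a) - (- b)) +ℤ (- c) ≡ - ((a - b) +ℤ c)
    regroup = solve-∀

module Homology {n : ℕ} (E : Fin n → Fin n → Set) where

  Null-cong : ∀ {c c' : Chain1 n} → c ≐ c' → Null E c → Null E c'
  Null-cong eq (d , supp , ∂d) = d , supp , (λ u v → trans (∂d u v) (eq u v))

  Null-zero : Null E zeroChain
  Null-zero = (λ _ _ _ → 0ℤ) , (λ _ _ _ ne → ⊥-elim (ne refl)) , (λ _ _ → sumFin-zero n)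

  Null-+ : ∀ {c c' : Chain1 n} → Null E c → Null E c' → Null E (c ⊕ c')
  Null-+ (d , supp , ∂d) (d' , supp' , ∂d') =
    (λ a b x → d a b x +ℤ d' a b x) , supp+ ,
    (λ u v → trans (∂₂-+ d d' u v) (cong₂ _+ℤ_ (∂d u v) (∂d' u v)))
    where
    supp+ : ∀ a b x → d a b x +ℤ d' a b x ≢ 0ℤ → E a b × E b x × E a x
    supp+ a b x ne with d a b x ℤₚ.≟ 0ℤ
    ... | yes d≡0 = supp' a b x (λ d'≡0 → ne (cong₂ _+ℤ_ d≡0 d'≡0))
    ... | no d≢0 = supp a b x d≢0

  Null-neg : ∀ {c : Chain1 n} → Null E c → Null E (λ u v → - c u v)
  Null-neg (d , supp , ∂d) =
    (λ a b x → - d a b x) , (λ a b x ne → supp a b x (λ d≡0 → ne (cong -_ d≡0))) ,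
    (λ u v → trans (∂₂-neg d u v) (cong -_ (∂d u v)))

  -- A record rather than a synonym of Homologous, so that both chains can be inferred from its type.
  infix 4 _∼_
  record _∼_ (c c' : Chain1 n) : Set where
    constructor homologous
    field null-difference : Null E (λ u v → c u v - c' u v)
  open _∼_ public

  private
    lemma-0 : ∀ x → 0ℤ ≡ x - x
    lemma-0 = solve-∀
    lemma-sym : ∀ x y → - (x - y) ≡ y - x
    lemma-sym = solve-∀
    lemma-trans : ∀ x y z → (x - y) +ℤ (y - z) ≡ x - z
    lemma-trans = solve-∀
    lemma-+ : ∀ x x' y y' → (x - x') +ℤ (y - y') ≡ (x +ℤ y) - (x' +ℤ y')
    lemma-+ = solve-∀
    lemma-cancel : ∀ a b c → (a +ℤ b) - (a +ℤ c) ≡ b - c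
    lemma-cancel = solve-∀
    lemma-triangle : ∀ x y z → (y - z) +ℤ x ≡ (x +ℤ y) - z
    lemma-triangle = solve-∀

  ≐⇒∼ : ∀ {c c'} → c ≐ c' → c ∼ c'
  ≐⇒∼ {c} eq = homologous (Null-cong (λ u v → trans (lemma-0 (c u v)) (cong (λ t → c u v - t) (eq u v))) Null-zero)

  ∼-refl : ∀ {c} → c ∼ c
  ∼-refl = ≐⇒∼ (λ _ _ → refl)

  ∼-sym : ∀ {c c'} → c ∼ c' → c' ∼ c
  ∼-sym {c} {c'} (homologous p) = homologous (Null-cong (λ u v → lemma-sym (c u v) (c' u v)) (Null-neg p))

  ∼-trans : ∀ {c c' c''} → c ∼ c' → c' ∼ c'' → c ∼ c''
  ∼-trans {c} {c'} {c''} (homologous p) (homologous q) =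
    homologous (Null-cong (λ u v → lemma-trans (c u v) (c' u v) (c'' u v)) (Null-+ p q))

  ∼-setoid : Setoid _ _
  ∼-setoid = record
    { Carrier = Chain1 n ; _≈_ = _∼_
    ; isEquivalence = record { refl = ∼-refl ; sym = ∼-sym ; trans = ∼-trans } }

  Null⇒∼0 : ∀ {c} → Null E c → c ∼ zeroChain
  Null⇒∼0 {c} p = homologous (Null-cong (λ u v → sym (ℤₚ.+-identityʳ (c u v))) p)

  ∼0⇒Null : ∀ {c} → c ∼ zeroChain → Null E c
  ∼0⇒Null {c} (homologous p) = Null-cong (λ u v → ℤₚ.+-identityʳ (c u v)) p

  ⊕-cong : ∀ {a a' b b'} → a ∼ a' → b ∼ b' → a ⊕ b ∼ a' ⊕ b'
  ⊕-cong {a} {a'} {b} {b'} (homologous p) (homologous q) =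
    homologous (Null-cong (λ u v → lemma-+ (a u v) (a' u v) (b u v) (b' u v)) (Null-+ p q))

  ⊕-congˡ : ∀ a {b b'} → b ∼ b' → a ⊕ b ∼ a ⊕ b'
  ⊕-congˡ a = ⊕-cong (∼-refl {a})

  ⊕-congʳ : ∀ {a a'} b → a ∼ a' → a ⊕ b ∼ a' ⊕ b
  ⊕-congʳ b p = ⊕-cong p (∼-refl {b})

  ⊕-cancelˡ : ∀ a {b c} → a ⊕ b ∼ a ⊕ c → b ∼ c
  ⊕-cancelˡ a {b} {c} (homologous p) = homologous (Null-cong (λ u v → lemma-cancel (a u v) (b u v) (c u v)) p)

  ⊕-comm : ∀ a b → a ⊕ b ∼ b ⊕ a
  ⊕-comm a b = ≐⇒∼ (λ u v → ℤₚ.+-comm (a u v) (b u v))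

  ⊕-assoc : ∀ a b c → (a ⊕ b) ⊕ c ∼ a ⊕ (b ⊕ c)
  ⊕-assoc a b c = ≐⇒∼ (λ u v → ℤₚ.+-assoc (a u v) (b u v) (c u v))

  ⊕-identityˡ : ∀ a → zeroChain ⊕ a ∼ a
  ⊕-identityˡ a = ≐⇒∼ (λ u v → ℤₚ.+-identityˡ (a u v))

  ⊕-identityʳ : ∀ a → a ⊕ zeroChain ∼ a
  ⊕-identityʳ a = ≐⇒∼ (λ u v → ℤₚ.+-identityʳ (a u v))

  edge-triangle : ∀ {a b c} → E a b → E b c → E a c → edgeChain a b ⊕ edgeChain b c ∼ edgeChain a c
  edge-triangle {a} {b} {c} eab ebc eac = homologous (Null-cong
    (λ u v → trans (∂₂-simplex a b c u v) (lemma-triangle (edgeChain a b u v) (edgeChain b c u v) (edgeChain a c u v)))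
    (simplex a b c , supp , λ _ _ → refl))
    where
    supp : ∀ x y w → simplex a b c x y w ≢ 0ℤ → E x y × E y w × E x w
    supp x y w ne with simplex-support a b c x y w ne
    ... | refl , refl , refl = eab , ebc , eac

  edge-loop : ∀ {x} → E x x → edgeChain x x ∼ zeroChain
  edge-loop {x} exx = ⊕-cancelˡ (edgeChain x x)
    (∼-trans (edge-triangle exx exx exx) (∼-sym (⊕-identityʳ (edgeChain x x))))

  chainSum-cong∼ : ∀ s {F G : ℕ → Chain1 n} → (∀ i → i < s → F i ∼ G i) →
    chainSum (applyUpTo F s) ∼ chainSum (applyUpTo G s)
  chainSum-cong∼ zero eq = ∼-refl
  chainSum-cong∼ (suc s) eq = ⊕-cong (eq 0 (s≤s z≤n)) (chainSum-cong∼ s (λ i i<s → eq (suc i) (s≤s i<s)))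

module _ {n : ℕ} where

  walkChain : (ℕ → Fin n) → ℕ → Chain1 n
  walkChain f zero = zeroChain
  walkChain f (suc k) = edgeChain (f 0) (f 1) ⊕ walkChain (λ t → f (suc t)) k

  walkChain-cong : ∀ k {f h : ℕ → Fin n} → (∀ t → t ≤ k → f t ≡ h t) → walkChain f k ≐ walkChain h k
  walkChain-cong zero eq u v = refl
  walkChain-cong (suc k) eq u v = cong₂ _+ℤ_
    (cong₂ (λ a b → edgeChain a b u v) (eq 0 z≤n) (eq 1 (s≤s z≤n)))
    (walkChain-cong k (λ t t≤k → eq (suc t) (s≤s t≤k)) u v)

  walkChain-+ : ∀ a b (f : ℕ → Fin n) → walkChain f (a + b) ≐ walkChain f a ⊕ walkChain (λ t → f (a + t)) b
  walkChain-+ zero b f u v = sym (ℤₚ.+-identityˡ _)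
  walkChain-+ (suc a) b f u v =
    trans (cong (edgeChain (f 0) (f 1) u v +ℤ_) (walkChain-+ a b (λ t → f (suc t)) u v))
          (sym (ℤₚ.+-assoc (edgeChain (f 0) (f 1) u v) _ _))

  walkChain-snoc : ∀ k (f : ℕ → Fin n) → walkChain f (suc k) ≐ walkChain f k ⊕ edgeChain (f k) (f (suc k))
  walkChain-snoc zero f u v = trans (ℤₚ.+-identityʳ (edgeChain (f 0) (f 1) u v)) (sym (ℤₚ.+-identityˡ _))
  walkChain-snoc (suc k) f u v =
    trans (cong (edgeChain (f 0) (f 1) u v +ℤ_) (walkChain-snoc k (λ t → f (suc t)) u v))
          (sym (ℤₚ.+-assoc (edgeChain (f 0) (f 1) u v) _ _))

  pathChain-snoc : ∀ k (f : ℕ → Fin n) y →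
    pathChain (applyUpTo f (suc k) ++ [ y ]) ≐ walkChain f k ⊕ edgeChain (f k) y
  pathChain-snoc zero f y u v = trans (ℤₚ.+-identityʳ (edgeChain (f 0) y u v)) (sym (ℤₚ.+-identityˡ _))
  pathChain-snoc (suc k) f y u v =
    trans (cong (edgeChain (f 0) (f 1) u v +ℤ_) (pathChain-snoc k (λ t → f (suc t)) y u v))
          (sym (ℤₚ.+-assoc (edgeChain (f 0) (f 1) u v) _ _))

  closedChain-upTo : ∀ k (f : ℕ → Fin n) →
    closedChain (map f (upTo (suc k))) ≐ walkChain (λ t → f (t % suc k)) (suc k)
  closedChain-upTo k f u v = begin
    closedChain (map f (upTo (suc k))) u v
      ≡⟨ cong (λ L → closedChain L u v) (map-upTo f (suc k)) ⟩
    pathChain (applyUpTo f (suc k) ++ [ f 0 ]) u v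
      ≡⟨ pathChain-snoc k f (f 0) u v ⟩
    (walkChain f k ⊕ edgeChain (f k) (f 0)) u v
      ≡⟨ cong₂ _+ℤ_ (walkChain-cong k (λ t t≤k → cong f (sym (m≤n⇒m%n≡m t≤k))) u v)
                    (cong₂ (λ a b → edgeChain a b u v) (cong f (sym (m≤n⇒m%n≡m ≤-refl)))
                                                      (cong f (sym (n%n≡0 (suc k))))) ⟩
    (walkChain f′ k ⊕ edgeChain (f′ k) (f′ (suc k))) u v
      ≡⟨ walkChain-snoc k f′ u v ⟨
    walkChain f′ (suc k) u v ∎
    where
    open ≡-Reasoning
    f′ : ℕ → Fin n
    f′ t = f (t % suc k)

  chainSum-cong : ∀ s {F G : ℕ → Chain1 n} → (∀ i → F i ≐ G i) → chainSum (applyUpTo F s) ≐ chainSum (applyUpTo G s)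
  chainSum-cong zero eq u v = refl
  chainSum-cong (suc s) eq u v = cong₂ _+ℤ_ (eq 0 u v) (chainSum-cong s (λ i → eq (suc i)) u v)

  walkChain-blocks : ∀ s g (P : ℕ → Fin n) →
    walkChain P (s * g) ≐ chainSum (applyUpTo (λ i → walkChain (λ j → P (i * g + j)) g) s)
  walkChain-blocks zero g P u v = refl
  walkChain-blocks (suc s) g P u v = trans (walkChain-+ g (s * g) P u v)
    (cong (walkChain P g u v +ℤ_)
      (trans (walkChain-blocks s g (λ t → P (g + t)) u v)
        (chainSum-cong s (λ i → walkChain-cong g (λ j _ → cong P (sym (+-assoc g (i * g) j)))) u v)))

module WalkHomotopy {n : ℕ} (E : Fin n → Fin n → Set) where
  open Homology E
  open SetoidReasoning ∼-setoid

  -- Top edge a b, bottom edge c d; the diagonal a d splits it into two triangles.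
  Square : Fin n → Fin n → Fin n → Fin n → Set
  Square a b c d = E a b × E b d × E a d × E a c × E c d

  walkChain-ladder : ∀ k (P Q : ℕ → Fin n) → (∀ t → t < k → Square (P t) (P (suc t)) (Q t) (Q (suc t))) →
    walkChain P k ⊕ edgeChain (P k) (Q k) ∼ edgeChain (P 0) (Q 0) ⊕ walkChain Q k
  walkChain-ladder zero P Q sq = ∼-trans (⊕-identityˡ (edgeChain (P 0) (Q 0))) (∼-sym (⊕-identityʳ _))
  walkChain-ladder (suc k) P Q sq with sq 0 (s≤s z≤n)
  ... | eab , ebd , ead , eac , ecd = begin
      (e (P 0) (P 1) ⊕ walkChain P' k) ⊕ e (P' k) (Q' k)
        ≈⟨ ⊕-assoc (e (P 0) (P 1)) (walkChain P' k) (e (P' k) (Q' k)) ⟩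
      e (P 0) (P 1) ⊕ (walkChain P' k ⊕ e (P' k) (Q' k))
        ≈⟨ ⊕-congˡ (e (P 0) (P 1)) (walkChain-ladder k P' Q' (λ t t<k → sq (suc t) (s≤s t<k))) ⟩
      e (P 0) (P 1) ⊕ (e (P 1) (Q 1) ⊕ walkChain Q' k)
        ≈⟨ ∼-sym (⊕-assoc (e (P 0) (P 1)) (e (P 1) (Q 1)) (walkChain Q' k)) ⟩
      (e (P 0) (P 1) ⊕ e (P 1) (Q 1)) ⊕ walkChain Q' k
        ≈⟨ ⊕-congʳ (walkChain Q' k) (∼-trans (edge-triangle eab ebd ead) (∼-sym (edge-triangle eac ecd ead))) ⟩
      (e (P 0) (Q 0) ⊕ e (Q 0) (Q 1)) ⊕ walkChain Q' k
        ≈⟨ ⊕-assoc (e (P 0) (Q 0)) (e (Q 0) (Q 1)) (walkChain Q' k) ⟩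
      e (P 0) (Q 0) ⊕ (e (Q 0) (Q 1) ⊕ walkChain Q' k) ∎
    where
    e = edgeChain
    P' Q' : ℕ → Fin n
    P' t = P (suc t)
    Q' t = Q (suc t)

  closedWalks-homologous : ∀ k (P Q : ℕ → Fin n) →
    (∀ t → t < k → Square (P t) (P (suc t)) (Q t) (Q (suc t))) →
    P k ≡ P 0 → Q k ≡ Q 0 → walkChain P k ∼ walkChain Q k
  closedWalks-homologous k P Q sq Pk≡P0 Qk≡Q0 = ⊕-cancelˡ (edgeChain (P 0) (Q 0))
    (∼-trans (⊕-comm (edgeChain (P 0) (Q 0)) (walkChain P k))
      (subst (λ c → walkChain P k ⊕ c ∼ edgeChain (P 0) (Q 0) ⊕ walkChain Q k)
             (cong₂ edgeChain Pk≡P0 Qk≡Q0) (walkChain-ladder k P Q sq)))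

  constantWalk-null : ∀ k (f : ℕ → Fin n) x → (∀ t → t ≤ k → f t ≡ x) → E x x → walkChain f k ∼ zeroChain
  constantWalk-null zero f x eq exx = ∼-refl
  constantWalk-null (suc k) f x eq exx = ∼-trans
    (⊕-cong (subst₂ (λ a b → edgeChain a b ∼ zeroChain) (sym (eq 0 z≤n)) (sym (eq 1 (s≤s z≤n))) (edge-loop exx))
            (constantWalk-null k (λ t → f (suc t)) x (λ t t≤k → eq (suc t) (s≤s t≤k)) exx))
    (⊕-identityʳ zeroChain)

  stutteringWalk-homologous : Reflexive E → ∀ s' j (P R : ℕ → Fin n) →
    (∀ j' i → j' < j → i < suc s' → P (j' * suc s' + i) ≡ R j') → P (j * suc s') ≡ R j →
    walkChain P (j * suc s') ∼ walkChain R j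
  stutteringWalk-homologous reflE s' zero P R blocks end = ∼-refl
  stutteringWalk-homologous reflE s' (suc j) P R blocks end = begin
      walkChain P (S + j * S)
        ≈⟨ ≐⇒∼ (walkChain-+ S (j * S) P) ⟩
      walkChain P S ⊕ walkChain (λ t → P (S + t)) (j * S)
        ≈⟨ ⊕-cong firstBlock
             (stutteringWalk-homologous reflE s' j (λ t → P (S + t)) (λ t → R (suc t))
               (λ j' i j'<j i<S → trans (cong P (sym (+-assoc S (j' * S) i))) (blocks (suc j') i (s≤s j'<j) i<S))
               end) ⟩
      edgeChain (R 0) (R 1) ⊕ walkChain (λ t → R (suc t)) j ∎
    where
    S = suc s'
    secondBlockStart : ∀ j → (∀ j' i → j' < suc j → i < S → P (j' * S + i) ≡ R j') →
      P (suc j * S) ≡ R (suc j) → P S ≡ R 1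
    secondBlockStart zero _ end = trans (cong P (sym (+-identityʳ S))) end
    secondBlockStart (suc _) blocks _ =
      trans (cong P (sym (trans (+-identityʳ _) (+-identityʳ S)))) (blocks 1 0 (s≤s (s≤s z≤n)) (s≤s z≤n))
    PS≡R1 : P S ≡ R 1
    PS≡R1 = secondBlockStart j blocks end
    firstBlock : walkChain P S ∼ edgeChain (R 0) (R 1)
    firstBlock = begin
      walkChain P S
        ≈⟨ ≐⇒∼ (walkChain-snoc s' P) ⟩
      walkChain P s' ⊕ edgeChain (P s') (P S)
        ≈⟨ ⊕-congʳ (edgeChain (P s') (P S)) (constantWalk-null s' P (R 0) (λ t t≤s' → blocks 0 t (s≤s z≤n) (s≤s t≤s')) (reflE (R 0))) ⟩
      zeroChain ⊕ edgeChain (P s') (P S)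
        ≈⟨ ⊕-identityˡ _ ⟩
      edgeChain (P s') (P S)
        ≡⟨ cong₂ edgeChain (blocks 0 s' (s≤s z≤n) ≤-refl) PS≡R1 ⟩
      edgeChain (R 0) (R 1) ∎

quotient-unique : ∀ s a b {i i'} → i < s → i' < s → a * s + i ≡ b * s + i' → a ≡ b
quotient-unique s zero zero i<s i'<s eq = refl
quotient-unique s zero (suc b) {i} {i'} i<s i'<s eq =
  ⊥-elim (<⇒≢ (<-≤-trans i<s (≤-trans (m≤m+n s (b * s)) (m≤m+n (s + b * s) i'))) eq)
quotient-unique s (suc a) zero {i} {i'} i<s i'<s eq =
  ⊥-elim (<⇒≢ (<-≤-trans i'<s (≤-trans (m≤m+n s (a * s)) (m≤m+n (s + a * s) i))) (sym eq))
quotient-unique s (suc a) (suc b) {i} {i'} i<s i'<s eq = cong suc (quotient-unique s a b i<s i'<s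
  (+-cancelˡ-≡ s _ _ (trans (sym (+-assoc s (a * s) i)) (trans eq (+-assoc s (b * s) i')))))

successor-block : ∀ s j j' {i i'} → i < s → i' < s → suc (j * s + i) ≡ j' * s + i' → j' ≡ j ⊎ j' ≡ suc j
successor-block s j j' {i} i<s i'<s eq with suc i <? s
... | yes 1+i<s = inj₁ (sym (quotient-unique s j j' 1+i<s i'<s (trans (+-suc (j * s) i) eq)))
... | no 1+i≮s = inj₂ (sym (quotient-unique s (suc j) j' (≤-<-trans z≤n i<s) i'<s (begin
      suc j * s + 0   ≡⟨ +-identityʳ _ ⟩
      s + j * s       ≡⟨ +-comm s (j * s) ⟩
      j * s + s       ≡⟨ cong (j * s +_) (sym (≤-antisym i<s (≮⇒≥ 1+i≮s))) ⟩
      j * s + suc i   ≡⟨ +-suc (j * s) i ⟩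
      suc (j * s + i) ≡⟨ eq ⟩
      j' * s + _      ∎)))
  where open ≡-Reasoning

block-index< : ∀ {s g i j} → i < s → j < g → i * g + j < s * g
block-index< {s} {g} {i} i<s j<g = <-≤-trans (+-monoʳ-< (i * g) j<g) (subst (_≤ s * g) (+-comm g (i * g)) (*-monoˡ-≤ g i<s))

slice-index< : ∀ {s g j i} → j < g → i < s → j * s + i < s * g
slice-index< {s} {g} {j} {i} j<g i<s = subst (j * s + i <_) (*-comm g s) (block-index< j<g i<s)

block-bound : ∀ s g {J i} → J * s + i < s * g → J < g
block-bound s g {J} {i} lt = *-cancelʳ-< s J g (subst (J * s <_) (*-comm s g) (≤-<-trans (m≤m+n (J * s) i) lt))

CycAdj-sym : ∀ {m x y} → CycAdj m x y → CycAdj m y x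
CycAdj-sym (inj₁ e) = inj₁ (sym e)
CycAdj-sym (inj₂ (inj₁ e)) = inj₂ (inj₂ (inj₁ e))
CycAdj-sym (inj₂ (inj₂ (inj₁ e))) = inj₂ (inj₁ e)
CycAdj-sym (inj₂ (inj₂ (inj₂ (inj₁ e)))) = inj₂ (inj₂ (inj₂ (inj₂ e)))
CycAdj-sym (inj₂ (inj₂ (inj₂ (inj₂ e)))) = inj₂ (inj₂ (inj₂ (inj₁ e)))

PathAdj-sym : ∀ {x y} → PathAdj x y → PathAdj y x
PathAdj-sym (inj₁ e) = inj₁ (sym e)
PathAdj-sym (inj₂ (inj₁ e)) = inj₂ (inj₂ e)
PathAdj-sym (inj₂ (inj₂ e)) = inj₂ (inj₁ e)

CycAdj-% : ∀ {m t} .{{_ : NonZero m}} → t < m → CycAdj m (t % m) (suc t % m)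
CycAdj-% {m} {t} t<m rewrite m<n⇒m%n≡m t<m with suc t <? m
... | yes 1+t<m rewrite m<n⇒m%n≡m 1+t<m = inj₂ (inj₁ refl)
... | no 1+t≮m = inj₂ (inj₂ (inj₂ (inj₁ (1+t≡m , subst (λ x → x % m ≡ 0) (sym 1+t≡m) (n%n≡0 m)))))
  where
  1+t≡m : suc t ≡ m
  1+t≡m = ≤-antisym t<m (≮⇒≥ 1+t≮m)

cycle-neighbours : ∀ {k m} → 3 ≤ k → m < k → Σ[ p ∈ ℕ ] Σ[ q ∈ ℕ ]
  (p < k × q < k × CycAdj k m p × CycAdj k q m × m ≢ p × m ≢ q × p ≢ q)
cycle-neighbours {suc zero} {zero} (s≤s ()) _
cycle-neighbours {suc (suc zero)} {zero} (s≤s (s≤s ())) _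
cycle-neighbours {suc (suc (suc r))} {zero} _ _ =
  1 , suc (suc r) , s≤s (s≤s z≤n) , ≤-refl ,
  inj₂ (inj₁ refl) , inj₂ (inj₂ (inj₂ (inj₁ (refl , refl)))) , (λ ()) , (λ ()) , (λ ())
cycle-neighbours {k} {suc m} 3≤k m<k with suc (suc m) <? k
... | yes 2+m<k = suc (suc m) , m , 2+m<k , ≤-trans (n≤1+n _) m<k ,
  inj₂ (inj₁ refl) , inj₂ (inj₁ refl) , (1+n≢n ∘ sym) , 1+n≢n , 2+n≢n
  where
  2+n≢n : suc (suc m) ≢ m
  2+n≢n e = 1+n≰n (≤-trans (n≤1+n _) (≤-reflexive e))
... | no 2+m≮k = 0 , m , ≤-trans (s≤s z≤n) m<k , ≤-trans (n≤1+n _) m<k ,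
  inj₂ (inj₂ (inj₂ (inj₁ (2+m≡k , refl)))) , inj₂ (inj₁ refl) , (λ ()) , 1+n≢n , 0≢m
  where
  2+m≡k : suc (suc m) ≡ k
  2+m≡k = ≤-antisym m<k (≮⇒≥ 2+m≮k)
  0≢m : 0 ≢ m
  0≢m refl = 1+n≰n (≤-trans 3≤k (≤-reflexive (sym 2+m≡k)))

minimiser : ∀ k (h : ℕ → ℕ) → 0 < k → Σ[ m ∈ ℕ ] (m < k × (∀ a → a < k → h m ≤ h a))
minimiser (suc zero) h _ = 0 , s≤s z≤n , λ { zero _ → ≤-refl ; (suc a) (s≤s ()) }
minimiser (suc (suc k)) h _ with minimiser (suc k) h (s≤s z≤n)
... | m , m<k , minimal with h m ≤? h (suc k)
...   | yes hm≤ = m , ≤-trans m<k (n≤1+n _) , extended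
  where
  extended : ∀ a → a < suc (suc k) → h m ≤ h a
  extended a (s≤s a≤k) with a ≟ suc k
  ... | yes refl = hm≤
  ... | no a≢k = minimal a (≤∧≢⇒< a≤k a≢k)
...   | no hm≰ = suc k , ≤-refl , extended
  where
  extended : ∀ a → a < suc (suc k) → h (suc k) ≤ h a
  extended a (s≤s a≤k) with a ≟ suc k
  ... | yes refl = ≤-refl
  ... | no a≢k = ≤-trans (<⇒≤ (≰⇒> hm≰)) (minimal a (≤∧≢⇒< a≤k a≢k))

_++ʷ_ : ∀ {A : Set} {R : A → A → Set} {x y w} → Walk R x y → Walk R y w → Walk R x w
here ++ʷ q = q
step r p ++ʷ q = step r (p ++ʷ q)

module SumGadgetShape (s₁ g₁ ℓ : ℕ) (ℓ≢0 : ℓ ≢ 0) where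
  s = suc s₁
  g = suc g₁
  open Gadget s g ℓ

  0<s : 0 < s
  0<s = s≤s z≤n

  Same-refl : ∀ x → Same x x
  Same-refl (main a b) = refl , inj₁ refl
  Same-refl (ext i j) = refl , refl

  Adj-intro : ∀ {x y} x' y' → Valid x → Valid y → Valid x' → Valid y' → Same x x' → Same y y' → RawAdj x' y' → Adj x y
  Adj-intro x' y' vx vy vx' vy' sx sy r = vx , vy , x' , y' , vx' , vy' , sx , sy , r

  RawAdj-sym : ∀ x y → RawAdj x y → RawAdj y x
  RawAdj-sym (main a b) (main a' b') (p , c) = PathAdj-sym p , CycAdj-sym c
  RawAdj-sym (ext i j) (ext i' j') (e , c) = sym e , CycAdj-sym c
  RawAdj-sym (ext i j) (main a b) (a≡0 , j' , j'<g , eb , c) = a≡0 , j' , j'<g , eb , CycAdj-sym c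
  RawAdj-sym (main a b) (ext i j) (a≡0 , j' , j'<g , eb , c) = a≡0 , j' , j'<g , eb , CycAdj-sym c

  Adj-sym : ∀ x y → Adj x y → Adj y x
  Adj-sym x y (vx , vy , x' , y' , vx' , vy' , sx , sy , r) = vy , vx , y' , x' , vy' , vx' , sy , sx , RawAdj-sym x' y' r

  ZV-valid : ∀ {j} → j < g → Valid (ZV j)
  ZV-valid {j} j<g = ≤-refl , subst (_< s * g) (+-identityʳ (j * s)) (slice-index< j<g 0<s)

  lastOfBlock : ℕ → RV
  lastOfBlock j = main ℓ (j * s + s₁)

  lastOfBlock-valid : ∀ {j} → j < g → Valid (lastOfBlock j)
  lastOfBlock-valid j<g = ≤-refl , slice-index< j<g ≤-refl

  Same-lastOfBlock : ∀ j → Same (ZV j) (lastOfBlock j)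
  Same-lastOfBlock j = refl , inj₂ (inj₁ (refl , (j , 0 , s₁ , 0<s , ≤-refl , sym (+-identityʳ (j * s)) , refl)))

  lastOfBlock-suc : ∀ j → suc (j * s + s₁) ≡ suc j * s
  lastOfBlock-suc j = trans (sym (+-suc (j * s) s₁)) (+-comm (j * s) s)

  blockOf : ∀ j a b → Same (ZV j) (main a b) → Σ[ i ∈ ℕ ] (i < s × b ≡ j * s + i)
  blockOf j a b (_ , inj₁ e) = 0 , 0<s , trans (sym e) (sym (+-identityʳ (j * s)))
  blockOf j a b (_ , inj₂ (inj₁ (_ , (J , x , i , x<s , i<s , e₁ , e₂)))) =
    i , i<s , trans e₂ (cong (λ t → t * s + i) (sym (quotient-unique s j J 0<s x<s (trans (+-identityʳ (j * s)) e₁))))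
  blockOf j a b (_ , inj₂ (inj₂ (ℓ≡0 , _))) = ⊥-elim (ℓ≢0 ℓ≡0)

  wraps-around : ∀ {x} → x ≡ s * g → x ≡ g * s + 0
  wraps-around e = trans e (trans (*-comm s g) (sym (+-identityʳ (g * s))))

  block-CycAdj : ∀ {j j' i i'} → j < g → j' < g → i < s → i' < s →
    CycAdj (s * g) (j * s + i) (j' * s + i') → CycAdj g j j'
  block-CycAdj {j} {j'} j<g j'<g i<s i'<s (inj₁ e) = inj₁ (quotient-unique s j j' i<s i'<s e)
  block-CycAdj {j} {j'} j<g j'<g i<s i'<s (inj₂ (inj₁ e)) with successor-block s j j' i<s i'<s e
  ... | inj₁ e' = inj₁ (sym e')
  ... | inj₂ e' = inj₂ (inj₁ (sym e'))
  block-CycAdj {j} {j'} j<g j'<g i<s i'<s (inj₂ (inj₂ (inj₁ e))) with successor-block s j' j i'<s i<s e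
  ... | inj₁ e' = inj₁ e'
  ... | inj₂ e' = inj₂ (inj₂ (inj₁ (sym e')))
  block-CycAdj {j} {j'} {i} {i'} j<g j'<g i<s i'<s (inj₂ (inj₂ (inj₂ (inj₁ (e , e₀)))))
    with successor-block s j g i<s 0<s (wraps-around e)
  ... | inj₁ g≡j = ⊥-elim (<-irrefl (sym g≡j) j<g)
  ... | inj₂ g≡1+j = inj₂ (inj₂ (inj₂ (inj₁ (sym g≡1+j , m*n≡0⇒m≡0 j' s (m+n≡0⇒m≡0 (j' * s) e₀)))))
  block-CycAdj {j} {j'} {i} {i'} j<g j'<g i<s i'<s (inj₂ (inj₂ (inj₂ (inj₂ (e , e₀)))))
    with successor-block s j' g i'<s 0<s (wraps-around e)
  ... | inj₁ g≡j' = ⊥-elim (<-irrefl (sym g≡j') j'<g)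
  ... | inj₂ g≡1+j' = inj₂ (inj₂ (inj₂ (inj₂ (sym g≡1+j' , m*n≡0⇒m≡0 j s (m+n≡0⇒m≡0 (j * s) e₀)))))

  Z-copy : IsCopyOfZ ZV
  Z-copy = (λ j → ZV-valid) , injective , (λ j j' j<g j'<g → reflect j<g j'<g , realise j<g j'<g)
    where
    injective : ∀ j j' → j < g → j' < g → Same (ZV j) (ZV j') → j ≡ j'
    injective j j' _ _ sm with blockOf j ℓ (j' * s) sm
    ... | i , i<s , e = sym (quotient-unique s j' j 0<s i<s (trans (+-identityʳ (j' * s)) e))

    reflect : ∀ {j j'} → j < g → j' < g → Adj (ZV j) (ZV j') → CycAdj g j j'
    reflect {j} {j'} j<g j'<g (_ , _ , main a b , main a' b' , _ , _ , sx , sy , (_ , c))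
      with blockOf j a b sx | blockOf j' a' b' sy
    ... | i , i<s , refl | i' , i'<s , refl = block-CycAdj j<g j'<g i<s i'<s c
    reflect _ _ (_ , _ , ext _ _ , _ , _ , _ , () , _ , _)
    reflect _ _ (_ , _ , main _ _ , ext _ _ , _ , _ , _ , () , _)

    -- A step j → j + 1 of Z is realised by the edge from the last vertex of block j to the first of block j + 1.
    viaLastOfBlock : ∀ {j j'} → j < g → j' < g → CycAdj (s * g) (j * s + s₁) (j' * s) → Adj (ZV j) (ZV j')
    viaLastOfBlock {j} {j'} j<g j'<g c =
      Adj-intro (lastOfBlock j) (ZV j') (ZV-valid j<g) (ZV-valid j'<g) (lastOfBlock-valid j<g) (ZV-valid j'<g)
        (Same-lastOfBlock j) (Same-refl (ZV j')) (inj₁ refl , c)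

    successor-step : ∀ {j j'} → suc j ≡ j' → CycAdj (s * g) (j * s + s₁) (j' * s)
    successor-step {j} e = inj₂ (inj₁ (trans (lastOfBlock-suc j) (cong (_* s) e)))

    wrap-step : ∀ {j j'} → suc j ≡ g × j' ≡ 0 → CycAdj (s * g) (j * s + s₁) (j' * s)
    wrap-step {j} (e , e₀) =
      inj₂ (inj₂ (inj₂ (inj₁ (trans (lastOfBlock-suc j) (trans (cong (_* s) e) (*-comm g s)) , cong (_* s) e₀))))

    realise : ∀ {j j'} → j < g → j' < g → CycAdj g j j' → Adj (ZV j) (ZV j')
    realise {j} {j'} j<g j'<g (inj₁ e) =
      Adj-intro (ZV j) (ZV j') (ZV-valid j<g) (ZV-valid j'<g) (ZV-valid j<g) (ZV-valid j'<g)
        (Same-refl (ZV j)) (Same-refl (ZV j')) (inj₁ refl , inj₁ (cong (_* s) e))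
    realise j<g j'<g (inj₂ (inj₁ e)) = viaLastOfBlock j<g j'<g (successor-step e)
    realise {j} {j'} j<g j'<g (inj₂ (inj₂ (inj₁ e))) = Adj-sym (ZV j') (ZV j) (viaLastOfBlock j'<g j<g (successor-step e))
    realise j<g j'<g (inj₂ (inj₂ (inj₂ (inj₁ w)))) = viaLastOfBlock j<g j'<g (wrap-step w)
    realise {j} {j'} j<g j'<g (inj₂ (inj₂ (inj₂ (inj₂ w)))) = Adj-sym (ZV j') (ZV j) (viaLastOfBlock j'<g j<g (wrap-step w))

  A-copy : ∀ {i} → i < s → IsCopyOfZ (ext i)
  A-copy {i} i<s = (λ j j<g → i<s , j<g) , (λ _ _ _ _ → proj₂) , (λ j j' j<g j'<g → reflect , realise j<g j'<g)
    where
    reflect : ∀ {j j'} → Adj (ext i j) (ext i j') → CycAdj g j j'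
    reflect (_ , _ , ext _ _ , ext _ _ , _ , _ , (_ , refl) , (_ , refl) , (_ , c)) = c
    reflect (_ , _ , main _ _ , _ , _ , _ , () , _ , _)
    reflect (_ , _ , ext _ _ , main _ _ , _ , _ , _ , () , _)
    realise : ∀ {j j'} → j < g → j' < g → CycAdj g j j' → Adj (ext i j) (ext i j')
    realise {j} {j'} j<g j'<g c =
      Adj-intro (ext i j) (ext i j') (i<s , j<g) (i<s , j'<g) (i<s , j<g) (i<s , j'<g) (refl , refl) (refl , refl) (refl , c)

  endCycles-copies : ∀ k → k < suc s → IsCopyOfZ (EndCyc k)
  endCycles-copies zero _ = Z-copy
  endCycles-copies (suc i) (s≤s i<s) = A-copy i<s

  endCycles-apart : ∀ k k' → k < suc s → k' < suc s → k ≢ k' → ∀ j j' → j < g → j' < g →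
    ¬ Same (EndCyc k j) (EndCyc k' j') × ¬ Adj (EndCyc k j) (EndCyc k' j')
  endCycles-apart zero zero _ _ k≢k' _ _ _ _ = ⊥-elim (k≢k' refl)
  endCycles-apart zero (suc i) _ _ _ j j' _ _ = (λ ()) , apart
    where
    apart : ¬ Adj (ZV j) (ext i j')
    apart (_ , _ , main _ _ , ext _ _ , _ , _ , (ℓ≡a , _) , _ , (a≡0 , _)) = ℓ≢0 (trans ℓ≡a a≡0)
    apart (_ , _ , ext _ _ , _ , _ , _ , () , _ , _)
    apart (_ , _ , main _ _ , main _ _ , _ , _ , _ , () , _)
  endCycles-apart (suc i) zero _ _ _ j j' _ _ = (λ ()) , apart
    where
    apart : ¬ Adj (ext i j) (ZV j')
    apart (_ , _ , ext _ _ , main _ _ , _ , _ , _ , (ℓ≡a , _) , (a≡0 , _)) = ℓ≢0 (trans ℓ≡a a≡0)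
    apart (_ , _ , main _ _ , _ , _ , _ , () , _ , _)
    apart (_ , _ , ext _ _ , ext _ _ , _ , _ , _ , () , _)
  endCycles-apart (suc i) (suc i') _ _ k≢k' j j' _ _ = (λ e → k≢k' (cong suc (proj₁ e))) , apart
    where
    apart : ¬ Adj (ext i j) (ext i' j')
    apart (_ , _ , ext _ _ , ext _ _ , _ , _ , (e₁ , _) , (e₂ , _) , (e₁₂ , _)) = k≢k' (cong suc (trans e₁ (trans e₁₂ (sym e₂))))
    apart (_ , _ , main _ _ , _ , _ , _ , () , _ , _)
    apart (_ , _ , ext _ _ , main _ _ , _ , _ , _ , () , _)

  endCycles-in-T : ∀ k → k < suc s → InT (EndCyc k 0)
  endCycles-in-T zero _ = (≤-refl , s≤s z≤n) , inj₁ (ℓ , ≤-refl , (refl , inj₁ refl))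
  endCycles-in-T (suc i) (s≤s i<s) = (i<s , s≤s z≤n) , inj₂ (i , i<s , (refl , refl))

  SameBlock-sym : ∀ {b c} → SameBlock b c → SameBlock c b
  SameBlock-sym (j , i , i' , i<s , i'<s , e , e') = j , i' , i , i'<s , i<s , e' , e

  SameBlock-trans : ∀ {b c d} → SameBlock b c → SameBlock c d → SameBlock b d
  SameBlock-trans (j , i , i' , i<s , i'<s , e₁ , e₂) (j' , x , x' , x<s , x'<s , e₃ , e₄)
    with quotient-unique s j j' i'<s x<s (trans (sym e₂) e₃)
  ... | refl = j , i , x' , i<s , x'<s , e₁ , e₄

  Same-sym : ∀ x y → Same x y → Same y x
  Same-sym (main a b) (main a' b') (refl , inj₁ refl) = refl , inj₁ refl
  Same-sym (main a b) (main a' b') (refl , inj₂ (inj₁ (a≡ℓ , sb))) = refl , inj₂ (inj₁ (a≡ℓ , SameBlock-sym sb))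
  Same-sym (main a b) (main a' b') (refl , inj₂ (inj₂ (a≡0 , m , m'))) = refl , inj₂ (inj₂ (a≡0 , m' , m))
  Same-sym (ext i j) (ext i' j') (e , e') = sym e , sym e'

  SameInSlice : ℕ → ℕ → ℕ → Set
  SameInSlice a b b' = b ≡ b' ⊎ (a ≡ ℓ × SameBlock b b') ⊎ (a ≡ 0 × MultipleOf g b × MultipleOf g b')

  Same-trans : ∀ x y w → Same x y → Same y w → Same x w
  Same-trans (main a b) (main _ _) (main _ _) (refl , d₁) (refl , d₂) = refl , combine d₁ d₂
    where
    combine : ∀ {b₁ b₂ b₃} → SameInSlice a b₁ b₂ → SameInSlice a b₂ b₃ → SameInSlice a b₁ b₃
    combine (inj₁ refl) d₂ = d₂
    combine d₁ (inj₁ refl) = d₁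
    combine (inj₂ (inj₁ (a≡ℓ , sb₁))) (inj₂ (inj₁ (_ , sb₂))) = inj₂ (inj₁ (a≡ℓ , SameBlock-trans sb₁ sb₂))
    combine (inj₂ (inj₁ (a≡ℓ , _))) (inj₂ (inj₂ (a≡0 , _))) = ⊥-elim (ℓ≢0 (trans (sym a≡ℓ) a≡0))
    combine (inj₂ (inj₂ (a≡0 , _))) (inj₂ (inj₁ (a≡ℓ , _))) = ⊥-elim (ℓ≢0 (trans (sym a≡ℓ) a≡0))
    combine (inj₂ (inj₂ (a≡0 , m₁ , _))) (inj₂ (inj₂ (_ , _ , m₃))) = inj₂ (inj₂ (a≡0 , m₁ , m₃))
  Same-trans (ext _ _) (ext _ _) (ext _ _) (refl , refl) (refl , refl) = refl , refl

  TWalk : RV → RV → Set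
  TWalk = Walk (λ x y → Adj x y × InT y)

  spine-valid : ∀ {j} → j ≤ ℓ → Valid (main j 0)
  spine-valid j≤ℓ = j≤ℓ , s≤s z≤n

  spine-in-T : ∀ {j} → j ≤ ℓ → InT (main j 0)
  spine-in-T {j} j≤ℓ = spine-valid j≤ℓ , inj₁ (j , j≤ℓ , Same-refl (main j 0))

  spine-Adj : ∀ {j j'} → j ≤ ℓ → j' ≤ ℓ → PathAdj j j' → Adj (main j 0) (main j' 0)
  spine-Adj {j} {j'} j≤ℓ j'≤ℓ p = Adj-intro (main j 0) (main j' 0)
    (spine-valid j≤ℓ) (spine-valid j'≤ℓ) (spine-valid j≤ℓ) (spine-valid j'≤ℓ)
    (Same-refl (main j 0)) (Same-refl (main j' 0)) (p , inj₁ refl)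

  spine-down : ∀ j → j ≤ ℓ → TWalk (main j 0) (main 0 0)
  spine-down zero _ = here
  spine-down (suc j) 1+j≤ℓ = step (spine-Adj 1+j≤ℓ j≤ℓ (inj₂ (inj₂ refl)) , spine-in-T j≤ℓ) (spine-down j j≤ℓ)
    where
    j≤ℓ = ≤-trans (n≤1+n j) 1+j≤ℓ

  spine-up : ∀ j → j ≤ ℓ → TWalk (main 0 0) (main j 0)
  spine-up zero _ = here
  spine-up (suc j) 1+j≤ℓ = spine-up j j≤ℓ ++ʷ step (spine-Adj j≤ℓ 1+j≤ℓ (inj₂ (inj₁ refl)) , spine-in-T 1+j≤ℓ) here
    where
    j≤ℓ = ≤-trans (n≤1+n j) 1+j≤ℓ

  T-spine-neighbour : ∀ u → InT u → Σ[ J ∈ ℕ ] (J ≤ ℓ × Adj u (main J 0))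
  T-spine-neighbour (main a b) (v , inj₁ (J , J≤ℓ , sm)) =
    J , J≤ℓ , Adj-intro (main J 0) (main J 0) v (spine-valid J≤ℓ) (spine-valid J≤ℓ) (spine-valid J≤ℓ)
                sm (Same-refl (main J 0)) (inj₁ refl , inj₁ refl)
  T-spine-neighbour (main a b) (v , inj₂ (_ , _ , ()))
  T-spine-neighbour (ext i j) (v , inj₁ (_ , _ , ()))
  T-spine-neighbour (ext i j) (v@(i<s , _) , inj₂ (_ , _ , (_ , j≡0))) =
    0 , z≤n , Adj-intro (ext i j) (main 0 (i * g)) v (spine-valid z≤n) v
      (z≤n , subst (_< s * g) (+-identityʳ (i * g)) (block-index< i<s (s≤s z≤n)))
      (Same-refl (ext i j)) (refl , inj₂ (inj₂ (refl , (0 , refl) , (i , refl))))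
      (refl , 0 , s≤s z≤n , sym (+-identityʳ (i * g)) , inj₁ j≡0)

  T-connected : ∀ u v → InT u → InT v → TWalk u v
  T-connected u v u∈T v∈T with T-spine-neighbour u u∈T | T-spine-neighbour v v∈T
  ... | J , J≤ℓ , u~J | J' , J'≤ℓ , v~J' =
    step (u~J , spine-in-T J≤ℓ) (spine-down J J≤ℓ ++ʷ spine-up J' J'≤ℓ)
      ++ʷ step (Adj-sym v (main J' 0) v~J' , v∈T) here

  level : RV → ℕ
  level (main a _) = suc a
  level (ext _ _) = 0

  T-main-on-spine : ∀ {a b} → InT (main a b) → Same (main a b) (main a 0)
  T-main-on-spine (_ , inj₁ (_ , _ , (_ , d))) = refl , d
  T-main-on-spine (_ , inj₂ (_ , _ , ()))

  T-upper-neighbour : ∀ x y → InT x → InT y → Adj x y → ¬ Same x y → level x ≤ level y → Same y (main (level x) 0)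
  T-upper-neighbour (ext _ _) _ _ _ (_ , _ , main _ _ , _ , _ , _ , () , _ , _) _ _
  T-upper-neighbour (ext _ _) (ext _ _) (_ , inj₂ (_ , _ , (_ , refl))) (_ , inj₂ (_ , _ , (_ , refl)))
    (_ , _ , ext _ _ , ext _ _ , _ , _ , (e₁ , _) , (e₂ , _) , (e₁₂ , _)) x≉y _ =
    ⊥-elim (x≉y (trans e₁ (trans e₁₂ (sym e₂)) , refl))
  T-upper-neighbour (ext _ _) (ext _ _) (_ , inj₁ (_ , _ , ())) _ _ _ _
  T-upper-neighbour (ext _ _) (ext _ _) (_ , inj₂ _) (_ , inj₁ (_ , _ , ())) _ _ _
  T-upper-neighbour (ext _ _) (main _ _) _ y∈T (_ , _ , ext _ _ , main _ _ , _ , _ , _ , (e , _) , (a≡0 , _)) _ _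
    with T-main-on-spine y∈T
  ... | (_ , d) = trans e a≡0 , d
  T-upper-neighbour (ext _ _) (main _ _) _ _ (_ , _ , ext _ _ , ext _ _ , _ , _ , _ , () , _) _ _
  T-upper-neighbour (main _ _) (ext _ _) _ _ _ _ ()
  T-upper-neighbour (main a b) (main a' b') x∈T y∈T (_ , _ , main _ _ , main _ _ , _ , _ , (e , _) , (e' , _) , (p , _)) x≉y x≤y
    with subst₂ PathAdj (sym e) (sym e') p
  ... | inj₁ refl = ⊥-elim (x≉y (Same-trans (main a b) (main a 0) (main a' b')
                      (T-main-on-spine x∈T) (Same-sym (main a' b') (main a 0) (T-main-on-spine y∈T))))
  ... | inj₂ (inj₁ refl) = T-main-on-spine y∈T
  ... | inj₂ (inj₂ refl) = ⊥-elim (1+n≰n (≤-pred x≤y))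
  T-upper-neighbour (main _ _) (main _ _) _ _ (_ , _ , main _ _ , ext _ _ , _ , _ , _ , () , _) _ _
  T-upper-neighbour (main _ _) (main _ _) _ _ (_ , _ , ext _ _ , _ , _ , _ , () , _ , _) _ _

  -- Both cycle-neighbours of a vertex of least level would have to be its unique upper neighbour.
  T-acyclic : ∀ k (f : ℕ → RV) → 3 ≤ k → (∀ a → a < k → InT (f a)) →
    (∀ a b → a < k → b < k → Same (f a) (f b) → a ≡ b) →
    (∀ a b → a < k → b < k → CycAdj k a b → Adj (f a) (f b)) → ⊥
  T-acyclic k f 3≤k in-T injective adjacent
    with minimiser k (level ∘ f) (≤-trans (s≤s z≤n) 3≤k)
  ... | m , m<k , least with cycle-neighbours 3≤k m<k
  ... | p , q , p<k , q<k , m~p , q~m , m≢p , m≢q , p≢q =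
    p≢q (injective p q p<k q<k (Same-trans (f p) (main (level (f m)) 0) (f q) upper-p
                                   (Same-sym (f q) (main (level (f m)) 0) upper-q)))
    where
    upper-p : Same (f p) (main (level (f m)) 0)
    upper-p = T-upper-neighbour (f m) (f p) (in-T m m<k) (in-T p p<k) (adjacent m p m<k p<k m~p)
      (m≢p ∘ injective m p m<k p<k) (least p p<k)
    upper-q : Same (f q) (main (level (f m)) 0)
    upper-q = T-upper-neighbour (f m) (f q) (in-T m m<k) (in-T q q<k)
      (Adj-sym (f q) (f m) (adjacent q m q<k m<k q~m)) (m≢q ∘ injective m q m<k q<k) (least q q<k)

  T-tree : InducedTree InT
  T-tree = T-connected , T-acyclic

module SliceHomology {n : ℕ} (E : Fin n → Fin n → Set) (reflE : Reflexive E) (s₁ g₁ ℓ : ℕ) where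
  s = suc s₁
  g = suc g₁
  m = s * g
  open Gadget s g ℓ
  open Homology E
  open WalkHomotopy E
  open SetoidReasoning ∼-setoid

  module _ (Γ : RV → Fin n) (hom : IsHom E Γ) where
    private
      Γ-Same = proj₁ hom
      Γ-edge = proj₂ hom

    closedChain-cycle : ∀ k (h : ℕ → RV) →
      closedChain (map Γ (map h (upTo (suc k)))) ≐ walkChain (λ t → Γ (h (t % suc k))) (suc k)
    closedChain-cycle k h u v =
      trans (cong (λ L → closedChain L u v) (sym (map-∘ (upTo (suc k))))) (closedChain-upTo k (Γ ∘ h) u v)

    slice : ℕ → ℕ → Fin n
    slice j t = Γ (main j (t % m))

    Zwalk : ℕ → Fin n
    Zwalk t = Γ (ZV (t % g))

    slice-square : ∀ {j t} → j < ℓ → t < m → Square (slice j t) (slice j (suc t)) (slice (suc j) t) (slice (suc j) (suc t))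
    slice-square {j} {t} j<ℓ t<m =
      Γ-edge (main j x) (main j y) (<⇒≤ j<ℓ , x<m) (<⇒≤ j<ℓ , y<m) (inj₁ refl , x~y) ,
      Γ-edge (main j y) (main (suc j) y) (<⇒≤ j<ℓ , y<m) (j<ℓ , y<m) (inj₂ (inj₁ refl) , inj₁ refl) ,
      Γ-edge (main j x) (main (suc j) y) (<⇒≤ j<ℓ , x<m) (j<ℓ , y<m) (inj₂ (inj₁ refl) , x~y) ,
      Γ-edge (main j x) (main (suc j) x) (<⇒≤ j<ℓ , x<m) (j<ℓ , x<m) (inj₂ (inj₁ refl) , inj₁ refl) ,
      Γ-edge (main (suc j) x) (main (suc j) y) (j<ℓ , x<m) (j<ℓ , y<m) (inj₁ refl , x~y)
      where
      x = t % m
      y = suc t % m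
      x~y : CycAdj m x y
      x~y = CycAdj-% t<m
      x<m : x < m
      x<m = m%n<n t m
      y<m : y < m
      y<m = m%n<n (suc t) m

    slice-closed : ∀ j → slice j m ≡ slice j 0
    slice-closed j = cong (λ x → Γ (main j x)) (n%n≡0 m)

    slice-homologous-bottom : ∀ j → j ≤ ℓ → walkChain (slice j) m ∼ walkChain (slice 0) m
    slice-homologous-bottom zero _ = ∼-refl
    slice-homologous-bottom (suc j) 1+j≤ℓ = ∼-trans
      (∼-sym (closedWalks-homologous m (slice j) (slice (suc j)) (λ t t<m → slice-square 1+j≤ℓ t<m)
                (slice-closed j) (slice-closed (suc j))))
      (slice-homologous-bottom j (≤-trans (n≤1+n j) 1+j≤ℓ))

    -- The top slice traverses Z, staying s steps on each vertex, since block j of ℓ × B is collapsed to vertex j.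
    top-slice-Z : walkChain (slice ℓ) m ∼ walkChain Zwalk g
    top-slice-Z = subst (λ q → walkChain (slice ℓ) q ∼ walkChain Zwalk g) (*-comm g s)
      (stutteringWalk-homologous reflE s₁ g (slice ℓ) Zwalk constant-on-blocks top-end)
      where
      constant-on-blocks : ∀ j i → j < g → i < s → slice ℓ (j * s + i) ≡ Zwalk j
      constant-on-blocks j i j<g i<s =
        trans (cong (λ x → Γ (main ℓ x)) (m<n⇒m%n≡m ji<m))
          (trans (Γ-Same (main ℓ (j * s + i)) (main ℓ (j * s)) (≤-refl , ji<m) (≤-refl , j0<m)
                    (refl , inj₂ (inj₁ (refl , (j , i , 0 , i<s , s≤s z≤n , refl , sym (+-identityʳ (j * s)))))))
             (cong (λ x → Γ (main ℓ (x * s))) (sym (m<n⇒m%n≡m j<g))))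
        where
        ji<m : j * s + i < m
        ji<m = slice-index< j<g i<s
        j0<m : j * s < m
        j0<m = subst (_< m) (+-identityʳ (j * s)) (slice-index< j<g (s≤s z≤n))
      top-end : slice ℓ (g * s) ≡ Zwalk g
      top-end = cong (λ x → Γ (main ℓ x))
        (trans (cong (_% m) (*-comm g s)) (trans (n%n≡0 m) (sym (cong (_* s) (n%n≡0 g)))))

    Z-chain : closedChain (map Γ (EndList 0)) ≐ walkChain Zwalk g
    Z-chain = closedChain-cycle g₁ ZV

    Z-null⇒slice-null : Null E (closedChain (map Γ (EndList 0))) →
      ∀ j → j ≤ ℓ → Null E (closedChain (map Γ (SliceList j)))
    Z-null⇒slice-null Z-null j j≤ℓ = ∼0⇒Null (begin
      closedChain (map Γ (SliceList j))  ≈⟨ ≐⇒∼ (closedChain-cycle (g₁ + s₁ * g) (main j)) ⟩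
      walkChain (slice j) m              ≈⟨ slice-homologous-bottom j j≤ℓ ⟩
      walkChain (slice 0) m              ≈⟨ ∼-sym (slice-homologous-bottom ℓ ≤-refl) ⟩
      walkChain (slice ℓ) m              ≈⟨ top-slice-Z ⟩
      walkChain Zwalk g                  ≈⟨ ∼-sym (≐⇒∼ Z-chain) ⟩
      closedChain (map Γ (EndList 0))    ≈⟨ Null⇒∼0 Z-null ⟩
      zeroChain                          ∎)

    A′walk : ℕ → ℕ → Fin n
    A′walk i t = Γ (main 0 (i * g + t % g))

    Awalk : ℕ → ℕ → Fin n
    Awalk i t = Γ (ext i (t % g))

    A′-valid : ∀ {i x} → i < s → x < g → Valid (main 0 (i * g + x))
    A′-valid i<s x<g = z≤n , block-index< i<s x<g

    -- The last vertex of block i is (0, (i + 1) g mod s g), which is identified with (0, i g).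
    bottom-slice-blocks : ∀ {i j} → i < s → j ≤ g → slice 0 (i * g + j) ≡ A′walk i j
    bottom-slice-blocks {i} {j} i<s j≤g with m≤n⇒m<n∨m≡n j≤g
    ... | inj₁ j<g = cong (λ x → Γ (main 0 x))
            (trans (m<n⇒m%n≡m (block-index< i<s j<g)) (cong (i * g +_) (sym (m<n⇒m%n≡m j<g))))
    ... | inj₂ refl = Γ-Same (main 0 ((i * g + g) % m)) (main 0 (i * g + g % g))
            (z≤n , m%n<n (i * g + g) m) (A′-valid i<s (m%n<n g g))
            (refl , inj₂ (inj₂ (refl , (suc i % s , end-multiple) , (i , start-multiple))))
      where
      end-multiple : (i * g + g) % m ≡ suc i % s * g
      end-multiple = trans (cong (_% m) (+-comm (i * g) g)) (sym (m%n*o≡m*o%[n*o] (suc i) s g))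
      start-multiple : i * g + g % g ≡ i * g
      start-multiple = trans (cong (i * g +_) (n%n≡0 g)) (+-identityʳ (i * g))

    A-square : ∀ {i t} → i < s → t < g → Square (A′walk i t) (A′walk i (suc t)) (Awalk i t) (Awalk i (suc t))
    A-square {i} {t} i<s t<g =
      subst₂ E (bottom-slice-blocks i<s (<⇒≤ t<g))
        (trans (cong (slice 0) (sym (+-suc (i * g) t))) (bottom-slice-blocks i<s t<g))
        (Γ-edge (main 0 (it % m)) (main 0 (suc it % m)) (z≤n , m%n<n it m) (z≤n , m%n<n (suc it) m)
                (inj₁ refl , CycAdj-% (block-index< i<s t<g))) ,
      Γ-edge (main 0 (i * g + y)) (ext i y) (A′-valid i<s y<g) (i<s , y<g) (refl , y , y<g , refl , inj₁ refl) ,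
      Γ-edge (main 0 (i * g + x)) (ext i y) (A′-valid i<s x<g) (i<s , y<g) (refl , x , x<g , refl , x~y) ,
      Γ-edge (main 0 (i * g + x)) (ext i x) (A′-valid i<s x<g) (i<s , x<g) (refl , x , x<g , refl , inj₁ refl) ,
      Γ-edge (ext i x) (ext i y) (i<s , x<g) (i<s , y<g) (refl , x~y)
      where
      it = i * g + t
      x = t % g
      y = suc t % g
      x~y : CycAdj g x y
      x~y = CycAdj-% t<g
      x<g : x < g
      x<g = m%n<n t g
      y<g : y < g
      y<g = m%n<n (suc t) g

    A′-homologous-A : ∀ {i} → i < s → walkChain (A′walk i) g ∼ walkChain (Awalk i) g
    A′-homologous-A {i} i<s = closedWalks-homologous g (A′walk i) (Awalk i) (λ t t<g → A-square i<s t<g)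
      (cong (λ x → Γ (main 0 (i * g + x))) (n%n≡0 g)) (cong (λ x → Γ (ext i x)) (n%n≡0 g))

    A-chain : ∀ i → closedChain (map Γ (EndList (suc i))) ≐ walkChain (Awalk i) g
    A-chain i = closedChain-cycle g₁ (ext i)

    Z-sum-of-A : Homologous E (closedChain (map Γ (EndList 0)))
      (chainSum (map (λ i → closedChain (map Γ (EndList (suc i)))) (upTo s)))
    Z-sum-of-A = null-difference (begin
      closedChain (map Γ (EndList 0))
        ≈⟨ ≐⇒∼ Z-chain ⟩
      walkChain Zwalk g
        ≈⟨ ∼-sym top-slice-Z ⟩
      walkChain (slice ℓ) m
        ≈⟨ slice-homologous-bottom ℓ ≤-refl ⟩
      walkChain (slice 0) m
        ≈⟨ ≐⇒∼ (walkChain-blocks s g (slice 0)) ⟩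
      chainSum (applyUpTo (λ i → walkChain (λ j → slice 0 (i * g + j)) g) s)
        ≈⟨ chainSum-cong∼ s (λ i i<s → begin
             walkChain (λ j → slice 0 (i * g + j)) g ≈⟨ ≐⇒∼ (walkChain-cong g (λ j j≤g → bottom-slice-blocks i<s j≤g)) ⟩
             walkChain (A′walk i) g                  ≈⟨ A′-homologous-A i<s ⟩
             walkChain (Awalk i) g                   ≈⟨ ∼-sym (≐⇒∼ (A-chain i)) ⟩
             closedChain (map Γ (EndList (suc i)))   ∎) ⟩
      chainSum (applyUpTo (λ i → closedChain (map Γ (EndList (suc i)))) s)
        ≡⟨ cong chainSum (sym (map-upTo (λ i → closedChain (map Γ (EndList (suc i)))) s)) ⟩
      chainSum (map (λ i → closedChain (map Γ (EndList (suc i)))) (upTo s)) ∎)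

module SummandWitness {n : ℕ} (E : Fin n → Fin n → Set) (reflE : Reflexive E)
    (g : ℕ) (z : ℕ → Fin n) (z-cycle : IsCycleH E g z) (s ℓ : ℕ) (0<g : 0 < g)
    (i : ℕ) (φ : ℕ → ℕ → ℕ) (φ-good : GoodPhi s g ℓ i φ) where
  open Gadget s g ℓ

  private
    φ-bound = proj₁ φ-good
    φ-edge = proj₁ (proj₂ φ-good)
    φ-bottom = proj₁ (proj₂ (proj₂ φ-good))
    φ-top = proj₁ (proj₂ (proj₂ (proj₂ φ-good)))
    φ-base = proj₂ (proj₂ (proj₂ (proj₂ φ-good)))
    z-edge = proj₂ z-cycle

  witness : RV → Fin n
  witness (main a b) = z (φ a b)
  witness (ext i' j) with i' ≟ i
  ... | yes _ = z j
  ... | no _ = z 0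

  witness-ext-self : ∀ j → witness (ext i j) ≡ z j
  witness-ext-self j with i ≟ i
  ... | yes _ = refl
  ... | no i≢i = ⊥-elim (i≢i refl)

  witness-ext-other : ∀ {i'} j → i' ≢ i → witness (ext i' j) ≡ z 0
  witness-ext-other {i'} j i'≢i with i' ≟ i
  ... | yes i'≡i = ⊥-elim (i'≢i i'≡i)
  ... | no _ = refl

  φ-bottom-multiple : ∀ {I} → I < s → φ 0 (I * g) ≡ 0
  φ-bottom-multiple {I} I<s with I ≟ i
  ... | yes I≡i = trans (cong (φ 0) (sym (+-identityʳ (I * g)))) (proj₁ (φ-bottom I 0 I<s 0<g) I≡i)
  ... | no I≢i = trans (cong (φ 0) (sym (+-identityʳ (I * g)))) (proj₂ (φ-bottom I 0 I<s 0<g) I≢i)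

  φ-top-block : ∀ {J i' b} → b ≡ J * s + i' → b < s * g → i' < s → φ ℓ b ≡ J
  φ-top-block {J} {i'} refl b<sg i'<s = φ-top J i' (block-bound s g {J} b<sg) i'<s

  φ-bottom-multiple′ : ∀ {b} → MultipleOf g b → b < s * g → φ 0 b ≡ 0
  φ-bottom-multiple′ {b} (I , refl) b<sg = φ-bottom-multiple (*-cancelʳ-< g I s b<sg)

  witness-Same : ∀ u v → Valid u → Valid v → Same u v → witness u ≡ witness v
  witness-Same (main a b) (main _ _) _ _ (refl , inj₁ refl) = refl
  witness-Same (main a b) (main _ b') (_ , b<sg) (_ , b'<sg) (refl , inj₂ (inj₁ (refl , (J , i₁ , i₂ , i₁<s , i₂<s , e₁ , e₂)))) =
    cong z (trans (φ-top-block {J} e₁ b<sg i₁<s) (sym (φ-top-block {J} e₂ b'<sg i₂<s)))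
  witness-Same (main a b) (main _ b') (_ , b<sg) (_ , b'<sg) (refl , inj₂ (inj₂ (refl , M , M'))) =
    cong z (trans (φ-bottom-multiple′ M b<sg) (sym (φ-bottom-multiple′ M' b'<sg)))
  witness-Same (ext _ _) (ext _ _) _ _ (refl , refl) = refl

  ext-main-edge : ∀ {i' j j'} → i' < s → j < g → j' < g → CycAdj g j j' →
    E (witness (ext i' j)) (witness (main 0 (i' * g + j')))
  ext-main-edge {i'} {j} {j'} i'<s j<g j'<g c with i' ≟ i
  ... | yes e = subst (λ t → E (z j) (z t)) (sym (proj₁ (φ-bottom i' j' i'<s j'<g) e)) (z-edge j j' j<g j'<g c)
  ... | no ne = subst (λ t → E (z 0) (z t)) (sym (proj₂ (φ-bottom i' j' i'<s j'<g) ne)) (reflE (z 0))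

  main-ext-edge : ∀ {i' j j'} → i' < s → j < g → j' < g → CycAdj g j' j →
    E (witness (main 0 (i' * g + j'))) (witness (ext i' j))
  main-ext-edge {i'} {j} {j'} i'<s j<g j'<g c with i' ≟ i
  ... | yes e = subst (λ t → E (z t) (z j)) (sym (proj₁ (φ-bottom i' j' i'<s j'<g) e)) (z-edge j' j j'<g j<g c)
  ... | no ne = subst (λ t → E (z t) (z 0)) (sym (proj₂ (φ-bottom i' j' i'<s j'<g) ne)) (reflE (z 0))

  witness-edge : ∀ u v → Valid u → Valid v → RawAdj u v → E (witness u) (witness v)
  witness-edge (main a b) (main a' b') (a≤ℓ , b<sg) (a'≤ℓ , b'<sg) (p , c) =
    z-edge _ _ (φ-bound a b a≤ℓ b<sg) (φ-bound a' b' a'≤ℓ b'<sg) (φ-edge a b a' b' a≤ℓ b<sg a'≤ℓ b'<sg p c)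
  witness-edge (ext i' j) (ext _ j') (_ , j<g) (_ , j'<g) (refl , c) with i' ≟ i
  ... | yes _ = z-edge j j' j<g j'<g c
  ... | no _ = reflE (z 0)
  witness-edge (ext i' j) (main _ _) (i'<s , j<g) _ (refl , j' , j'<g , refl , c) = ext-main-edge i'<s j<g j'<g c
  witness-edge (main _ _) (ext i' j) _ (i'<s , j<g) (refl , j' , j'<g , refl , c) = main-ext-edge i'<s j<g j'<g c

  witness-hom : IsHom E witness
  witness-hom = witness-Same , witness-edge

  witness-A : Homologous E (closedChain (map witness (EndList (suc i)))) (closedChain (map z (upTo g)))
  witness-A = subst (λ c → Homologous E c (closedChain (map z (upTo g))))
    (cong closedChain (sym (trans (sym (map-∘ (upTo g))) (map-cong witness-ext-self (upTo g)))))
    (null-difference (∼-refl {closedChain (map z (upTo g))}))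
    where open Homology E

  witness-T : ∀ u → InT u → witness u ≡ z 0
  witness-T (main a b) (v , inj₁ (J , J≤ℓ , sm)) =
    trans (witness-Same (main a b) (main J 0) v (J≤ℓ , ≤-<-trans z≤n (proj₂ v)) sm) (cong z (φ-base J J≤ℓ))
  witness-T (main a b) (v , inj₂ (_ , _ , ()))
  witness-T (ext i' j) (v , inj₁ (_ , _ , ()))
  witness-T (ext i' j) (v , inj₂ (_ , _ , (_ , refl))) with i' ≟ i
  ... | yes _ = refl
  ... | no _ = refl

lemma5p4 :
    ∀ {n} (E : Fin n → Fin n → Set) →
    Reflexive E → Symmetric E → Connected E → TriangleFree E → NontrivialH1 E →
    ∀ (g : ℕ) (z : ℕ → Fin n) → 4 ≤ g → ShortestNontrivialCycle E g z →
    ∀ (s : ℕ) → 2 ≤ s →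
    ∀ (ℓ : ℕ) → 2 ≤ ℓ →
    (∀ i → i < s → Σ[ φ ∈ (ℕ → ℕ → ℕ) ] GoodPhi s g ℓ i φ) →
    let open Gadget s g ℓ in
    -- end gadget-cycles Z, A₀, …, A_{s-1} are copies of Z
    (∀ k → k < suc s → IsCopyOfZ (EndCyc k)) ×
    -- pairwise at distance at least 2
    (∀ k k' → k < suc s → k' < suc s → k ≢ k' → ∀ j j' → j < g → j' < g →
       ¬ Same (EndCyc k j) (EndCyc k' j') × ¬ Adj (EndCyc k j) (EndCyc k' j')) ×
    -- T(S) is a tree containing the vertex 0 of each end gadget-cycle
    InducedTree InT ×
    (∀ k → k < suc s → InT (EndCyc k 0)) ×
    -- (1)
    (∀ (Γ : RV → Fin n) → IsHom E Γ →
       Null E (closedChain (map Γ (EndList 0))) →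
       ∀ j → j ≤ ℓ → Null E (closedChain (map Γ (SliceList j)))) ×
    -- (2)
    (∀ (Γ : RV → Fin n) → IsHom E Γ →
       Homologous E (closedChain (map Γ (EndList 0)))
         (chainSum (map (λ i → closedChain (map Γ (EndList (suc i)))) (upTo s)))) ×
    -- (3)
    (∀ i → i < s → Σ[ Γ ∈ (RV → Fin n) ]
       (IsHom E Γ ×
        Homologous E (closedChain (map Γ (EndList (suc i)))) (closedChain (map z (upTo g))) ×
        (∀ u → InT u → Γ u ≡ z 0) ×
        (∀ i' j → i' < s → i' ≢ i → j < g → Γ (ext i' j) ≡ z 0)))
lemma5p4 E reflE _ _ _ _ (suc g₁) z (s≤s _) (z-cycle , _) (suc s₁) (s≤s _) (suc ℓ₁) (s≤s _) φs =
  endCycles-copies , endCycles-apart , T-tree , endCycles-in-T ,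
  Z-null⇒slice-null , Z-sum-of-A ,
  λ i i<s → let (φ , φ-good) = φs i i<s
                open SummandWitness E reflE (suc g₁) z z-cycle (suc s₁) (suc ℓ₁) (s≤s z≤n) i φ φ-good
            in witness , witness-hom , witness-A , witness-T , (λ i' j _ i'≢i _ → witness-ext-other j i'≢i)
  where
  open SumGadgetShape s₁ g₁ (suc ℓ₁) (λ ())
  open SliceHomology E reflE s₁ g₁ (suc ℓ₁)
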